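{- Let $\mathbf{U}=(\mathbf{T},G,H)$ be an $\mathrm{itKI}_{c1}$-algebra and let $\epsilon$ be a congruence of $\mathbf{U}$. Then $\epsilon\cap C(T)^2$ is a congruence of $\mathrm{C}(\mathbf{U})$.
   Context: A centered Kleene algebra is $\langle T,\wedge,\vee,\sim,c,0,1\rangle$ with bounded distributive lattice reduct, $\sim\sim x=x$, $\sim(x\vee y)=\sim x\wedge\sim y$, $x\wedge\sim x\le y\vee\sim y$, $\sim c=c$. A KI-algebra is $\langle T,\wedge,\vee,\Rightarrow,\sim,c,0,1\rangle$ with centered Kleene reduct such that: $(a\Rightarrow b)\wedge(a\Rightarrow d)=a\Rightarrow(b\wedge d)$, $(a\Rightarrow d)\wedge(b\Rightarrow d)=(a\vee b)\Rightarrow d$, $0\Rightarrow a=1$, $a\Rightarrow 1=1$; $(x\wedge(x\Rightarrow y))\vee c\le y\vee c$; $c\Rightarrow c=1$; $(x\Rightarrow y)\wedge c=(\sim x\vee y)\wedge c$; $(x\Rightarrow\sim y)\vee c=(x\Rightarrow(\sim y\vee c))\wedge(y\Rightarrow(\sim x\vee c))$. A tense centered KI-algebra is $(\mathbf{T},G,H)$ with $F(x):=\sim G(\sim x)$, $P(x):=\sim H(\sim x)$, satisfying $G(1)=H(1)=1$; $G,H$ preserve $\wedge$; $x\le GP(x)$, $x\le HF(x)$; $G(x\vee y)\le G(x)\vee F(y)$, $H(x\vee y)\le H(x)\vee P(y)$; $G(x\Rightarrow y)\le G(x)\Rightarrow G(y)$, $H(x\Rightarrow y)\le H(x)\Rightarrow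 H(y)$; $G(x\Rightarrow y)\le F(x)\Rightarrow F(y)$, $H(x\Rightarrow y)\le P(x)\Rightarrow P(y)$; $G(c)=c=H(c)$. An $\mathrm{itKI}_{c1}$-algebra is a tense centered KI-algebra satisfying $x\Rightarrow x=1$ and (CK): for all $x,y\ge c$ with $x\wedge y\le c$ there is $z$ with $z\vee c=x$ and $\sim z\vee c=y$. Congruences of $\mathbf{U}$ are compatible with $\wedge,\vee,\Rightarrow,\sim,c,0,1,G,H$. $\mathrm{C}(\mathbf{U})$ is $C(T)=\{x\in T:x\ge c\}$ with $\wedge,\vee,\Rightarrow,G,H,F,P$ restricted, bottom $c$ and top $1$; its congruences are compatible with all these operations and constants. -}

module Defs where

open import Level using (Level; _⊔_; suc)
open import Relation.Binary.PropositionalEquality using (_≡_)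
open import Data.Product using (Σ; _×_)

record TenseCKI (a : Level) : Set (suc a) where
  infixr 7 _∧_
  infixr 6 _∨_
  infixr 5 _⇒_
  infix  4 _≤_
  field
    Carrier : Set a
    _∧_ _∨_ _⇒_ : Carrier → Carrier → Carrier
    ∼_ : Carrier → Carrier
    c 𝟘 𝟙 : Carrier
    G H : Carrier → Carrier

  _≤_ : Carrier → Carrier → Set a
  x ≤ y = x ∧ y ≡ x

  F : Carrier → Carrier
  F x = ∼ (G (∼ x))

  P : Carrier → Carrier
  P x = ∼ (H (∼ x))

  field
    ∧-comm   : ∀ x y → x ∧ y ≡ y ∧ x
    ∧-assoc  : ∀ x y z → (x ∧ y) ∧ z ≡ x ∧ (y ∧ z)
    ∨-comm   : ∀ x y → x ∨ y ≡ y ∨ x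
    ∨-assoc  : ∀ x y z → (x ∨ y) ∨ z ≡ x ∨ (y ∨ z)
    ∧-absorbs-∨ : ∀ x y → x ∧ (x ∨ y) ≡ x
    ∨-absorbs-∧ : ∀ x y → x ∨ (x ∧ y) ≡ x
    ∧-distribˡ-∨ : ∀ x y z → x ∧ (y ∨ z) ≡ (x ∧ y) ∨ (x ∧ z)
    ∨-identityʳ : ∀ x → x ∨ 𝟘 ≡ x
    ∧-identityʳ : ∀ x → x ∧ 𝟙 ≡ x
    ∼-invol  : ∀ x → ∼ (∼ x) ≡ x
    ∼-∨      : ∀ x y → ∼ (x ∨ y) ≡ (∼ x) ∧ (∼ y)
    kleene   : ∀ x y → x ∧ ∼ x ≤ y ∨ ∼ y
    ∼-c      : ∼ c ≡ c
    ⇒-∧ʳ     : ∀ a b d → (a ⇒ b) ∧ (a ⇒ d) ≡ a ⇒ (b ∧ d)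
    ⇒-∨ˡ     : ∀ a b d → (a ⇒ d) ∧ (b ⇒ d) ≡ (a ∨ b) ⇒ d
    𝟘⇒       : ∀ a → 𝟘 ⇒ a ≡ 𝟙
    ⇒𝟙       : ∀ a → a ⇒ 𝟙 ≡ 𝟙
    mp-c     : ∀ x y → (x ∧ (x ⇒ y)) ∨ c ≤ y ∨ c
    c⇒c      : c ⇒ c ≡ 𝟙
    ⇒-∧c     : ∀ x y → (x ⇒ y) ∧ c ≡ (∼ x ∨ y) ∧ c
    ⇒∼-∨c    : ∀ x y → (x ⇒ ∼ y) ∨ c ≡ (x ⇒ (∼ y ∨ c)) ∧ (y ⇒ (∼ x ∨ c))
    G𝟙       : G 𝟙 ≡ 𝟙
    H𝟙       : H 𝟙 ≡ 𝟙
    G-∧      : ∀ x y → G (x ∧ y) ≡ G x ∧ G y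
    H-∧      : ∀ x y → H (x ∧ y) ≡ H x ∧ H y
    x≤GPx    : ∀ x → x ≤ G (P x)
    x≤HFx    : ∀ x → x ≤ H (F x)
    G-∨      : ∀ x y → G (x ∨ y) ≤ G x ∨ F y
    H-∨      : ∀ x y → H (x ∨ y) ≤ H x ∨ P y
    G-⇒      : ∀ x y → G (x ⇒ y) ≤ G x ⇒ G y
    H-⇒      : ∀ x y → H (x ⇒ y) ≤ H x ⇒ H y
    G-⇒F     : ∀ x y → G (x ⇒ y) ≤ F x ⇒ F y
    H-⇒P     : ∀ x y → H (x ⇒ y) ≤ P x ⇒ P y
    Gc       : G c ≡ c
    Hc       : H c ≡ c

record ItKIc1 (a : Level) : Set (suc a) where
  field
    tense : TenseCKI a
  open TenseCKI tense public
  field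
    ⇒-refl : ∀ x → x ⇒ x ≡ 𝟙
    CK     : ∀ x y → c ≤ x → c ≤ y → x ∧ y ≤ c →
             Σ Carrier (λ z → (z ∨ c ≡ x) × (∼ z ∨ c ≡ y))

module _ {a : Level} (U : ItKIc1 a) where
  open ItKIc1 U

  record IsCongruence {ℓ} (ε : Carrier → Carrier → Set ℓ) : Set (a ⊔ ℓ) where
    field
      refl  : ∀ {x} → ε x x
      sym   : ∀ {x y} → ε x y → ε y x
      trans : ∀ {x y z} → ε x y → ε y z → ε x z
      ∧-cong : ∀ {x y x' y'} → ε x y → ε x' y' → ε (x ∧ x') (y ∧ y')
      ∨-cong : ∀ {x y x' y'} → ε x y → ε x' y' → ε (x ∨ x') (y ∨ y')
      ⇒-cong : ∀ {x y x' y'} → ε x y → ε x' y' → ε (x ⇒ x') (y ⇒ y')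
      ∼-cong : ∀ {x y} → ε x y → ε (∼ x) (∼ y)
      G-cong : ∀ {x y} → ε x y → ε (G x) (G y)
      H-cong : ∀ {x y} → ε x y → ε (H x) (H y)

  InC : Carrier → Set a
  InC x = c ≤ x

  -- A congruence of C(U): a binary relation θ on C(T) (encoded as a relation on
  -- T relating only elements of C(T)) which is an equivalence on C(T) and is
  -- compatible with ∧, ∨, ⇒, G, H, F, P (the constants c, 1 are nullary and
  -- compatibility with them is reflexivity).
  record IsCongruenceC {ℓ} (θ : Carrier → Carrier → Set ℓ) : Set (a ⊔ ℓ) where
    field
      support : ∀ {x y} → θ x y → InC x × InC y
      refl    : ∀ {x} → InC x → θ x x
      sym     : ∀ {x y} → θ x y → θ y x
      trans   : ∀ {x y z} → θ x y → θ y z → θ x z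
      ∧-cong : ∀ {x y x' y'} → θ x y → θ x' y' → θ (x ∧ x') (y ∧ y')
      ∨-cong : ∀ {x y x' y'} → θ x y → θ x' y' → θ (x ∨ x') (y ∨ y')
      ⇒-cong : ∀ {x y x' y'} → θ x y → θ x' y' → θ (x ⇒ x') (y ⇒ y')
      G-cong : ∀ {x y} → θ x y → θ (G x) (G y)
      H-cong : ∀ {x y} → θ x y → θ (H x) (H y)
      F-cong : ∀ {x y} → θ x y → θ (F x) (F y)
      P-cong : ∀ {x y} → θ x y → θ (P x) (P y)

  restrictC : ∀ {ℓ} → (Carrier → Carrier → Set ℓ) → Carrier → Carrier → Set (a ⊔ ℓ)
  restrictC ε x y = InC x × InC y × ε x y

module Submission where

open import Defs
open import Level using (Level)
open import Data.Product using (_,_)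
open import Relation.Binary.PropositionalEquality as ≡ using (cong; subst)
open ≡.≡-Reasoning

module Order {a : Level} (T : TenseCKI a) where
  open TenseCKI T

  ∧-greatest : ∀ {x y z} → x ≤ y → x ≤ z → x ≤ y ∧ z
  ∧-greatest {x} {y} {z} x≤y x≤z = begin
    x ∧ (y ∧ z)  ≡⟨ ≡.sym (∧-assoc x y z) ⟩
    (x ∧ y) ∧ z  ≡⟨ cong (_∧ z) x≤y ⟩
    x ∧ z        ≡⟨ x≤z ⟩
    x            ∎

  x≤y⇒x≤y∨z : ∀ {x y} z → x ≤ y → x ≤ y ∨ z
  x≤y⇒x≤y∨z {x} {y} z x≤y = begin
    x ∧ (y ∨ z)        ≡⟨ ∧-distribˡ-∨ x y z ⟩
    (x ∧ y) ∨ (x ∧ z)  ≡⟨ cong (_∨ (x ∧ z)) x≤y ⟩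
    x ∨ (x ∧ z)        ≡⟨ ∨-absorbs-∧ x z ⟩
    x                  ∎

  x≤y⇒x≤z∨y : ∀ {x y} z → x ≤ y → x ≤ z ∨ y
  x≤y⇒x≤z∨y {x} {y} z x≤y = subst (x ≤_) (∨-comm y z) (x≤y⇒x≤y∨z z x≤y)

  ∼-antitone : ∀ {x y} → x ≤ y → ∼ y ≤ ∼ x
  ∼-antitone {x} {y} x≤y = begin
    ∼ y ∧ ∼ x        ≡⟨ ≡.sym (∼-∨ y x) ⟩
    ∼ (y ∨ x)        ≡⟨ cong (λ w → ∼ (y ∨ w)) (≡.trans (≡.sym x≤y) (∧-comm x y)) ⟩
    ∼ (y ∨ (y ∧ x))  ≡⟨ cong ∼_ (∨-absorbs-∧ y x) ⟩
    ∼ y              ∎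

  G-monotone : ∀ {x y} → x ≤ y → G x ≤ G y
  G-monotone {x} {y} x≤y = ≡.trans (≡.sym (G-∧ x y)) (cong G x≤y)

  H-monotone : ∀ {x y} → x ≤ y → H x ≤ H y
  H-monotone {x} {y} x≤y = ≡.trans (≡.sym (H-∧ x y)) (cong H x≤y)

  c≤x⇒∼x≤c : ∀ {x} → c ≤ x → ∼ x ≤ c
  c≤x⇒∼x≤c c≤x = subst (_ ≤_) ∼-c (∼-antitone c≤x)

  x≤c⇒c≤∼x : ∀ {x} → x ≤ c → c ≤ ∼ x
  x≤c⇒c≤∼x x≤c = subst (_≤ _) ∼-c (∼-antitone x≤c)

module CenterUpset {a : Level} (T : TenseCKI a) where
  open TenseCKI T
  open Order T

  c≤-∨ : ∀ {x y} → c ≤ x → c ≤ y → c ≤ x ∨ y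
  c≤-∨ {y = y} c≤x _ = x≤y⇒x≤y∨z y c≤x

  c≤-⇒ : ∀ {x y} → c ≤ x → c ≤ y → c ≤ x ⇒ y
  c≤-⇒ {x} {y} _ c≤y = begin
    c ∧ (x ⇒ y)    ≡⟨ ∧-comm c (x ⇒ y) ⟩
    (x ⇒ y) ∧ c    ≡⟨ ⇒-∧c x y ⟩
    (∼ x ∨ y) ∧ c  ≡⟨ ∧-comm (∼ x ∨ y) c ⟩
    c ∧ (∼ x ∨ y)  ≡⟨ x≤y⇒x≤z∨y (∼ x) c≤y ⟩
    c              ∎

  c≤-G : ∀ {x} → c ≤ x → c ≤ G x
  c≤-G c≤x = subst (_≤ _) Gc (G-monotone c≤x)

  c≤-H : ∀ {x} → c ≤ x → c ≤ H x
  c≤-H c≤x = subst (_≤ _) Hc (H-monotone c≤x)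

  ≤c-G : ∀ {x} → x ≤ c → G x ≤ c
  ≤c-G x≤c = subst (_ ≤_) Gc (G-monotone x≤c)

  ≤c-H : ∀ {x} → x ≤ c → H x ≤ c
  ≤c-H x≤c = subst (_ ≤_) Hc (H-monotone x≤c)

  c≤-F : ∀ {x} → c ≤ x → c ≤ F x
  c≤-F c≤x = x≤c⇒c≤∼x (≤c-G (c≤x⇒∼x≤c c≤x))

  c≤-P : ∀ {x} → c ≤ x → c ≤ P x
  c≤-P c≤x = x≤c⇒c≤∼x (≤c-H (c≤x⇒∼x≤c c≤x))

module Restriction {a ℓ : Level} (U : ItKIc1 a)
                   (ε : ItKIc1.Carrier U → ItKIc1.Carrier U → Set ℓ) where
  open ItKIc1 U

  restrictC-cong₁ : (f : Carrier → Carrier) →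
                    (∀ {x} → InC U x → InC U (f x)) →
                    (∀ {x y} → ε x y → ε (f x) (f y)) →
                    ∀ {x y} → restrictC U ε x y → restrictC U ε (f x) (f y)
  restrictC-cong₁ f closed cong-f (x∈C , y∈C , x≈y) = closed x∈C , closed y∈C , cong-f x≈y

  restrictC-cong₂ : {_•_ : Carrier → Carrier → Carrier} →
                    (∀ {x y} → InC U x → InC U y → InC U (x • y)) →
                    (∀ {x y x' y'} → ε x y → ε x' y' → ε (x • x') (y • y')) →
                    ∀ {x y x' y'} → restrictC U ε x y → restrictC U ε x' y' →
                    restrictC U ε (x • x') (y • y')
  restrictC-cong₂ closed cong-• (x∈C , y∈C , x≈y) (x'∈C , y'∈C , x'≈y') =
    closed x∈C x'∈C , closed y∈C y'∈C , cong-• x≈y x'≈y'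

module CongruenceProperties {a ℓ : Level} (U : ItKIc1 a)
                           {ε : ItKIc1.Carrier U → ItKIc1.Carrier U → Set ℓ}
                           (isCong : IsCongruence U ε) where
  open ItKIc1 U
  open IsCongruence isCong

  F-cong : ∀ {x y} → ε x y → ε (F x) (F y)
  F-cong x≈y = ∼-cong (G-cong (∼-cong x≈y))

  P-cong : ∀ {x y} → ε x y → ε (P x) (P y)
  P-cong x≈y = ∼-cong (H-cong (∼-cong x≈y))

lemma7p3 : {a ℓ : Level} (U : ItKIc1 a) (ε : ItKIc1.Carrier U → ItKIc1.Carrier U → Set ℓ) →
           IsCongruence U ε → IsCongruenceC U (restrictC U ε)
lemma7p3 U ε isCong = record
  { support = λ { (x∈C , y∈C , _) → x∈C , y∈C }
  ; refl    = λ x∈C → x∈C , x∈C , E.refl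
  ; sym     = λ { (x∈C , y∈C , x≈y) → y∈C , x∈C , E.sym x≈y }
  ; trans   = λ { (x∈C , _ , x≈y) (_ , z∈C , y≈z) → x∈C , z∈C , E.trans x≈y y≈z }
  ; ∧-cong  = restrictC-cong₂ ∧-greatest E.∧-cong
  ; ∨-cong  = restrictC-cong₂ c≤-∨ E.∨-cong
  ; ⇒-cong  = restrictC-cong₂ c≤-⇒ E.⇒-cong
  ; G-cong  = restrictC-cong₁ G c≤-G E.G-cong
  ; H-cong  = restrictC-cong₁ H c≤-H E.H-cong
  ; F-cong  = restrictC-cong₁ F c≤-F (F-cong U isCong)
  ; P-cong  = restrictC-cong₁ P c≤-P (P-cong U isCong)
  }
  where
    module E = IsCongruence isCong
    open ItKIc1 U using (G; H; F; P)
    open Order (ItKIc1.tense U) using (∧-greatest)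
    open CenterUpset (ItKIc1.tense U)
    open Restriction U ε
    open CongruenceProperties using (F-cong; P-cong)
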